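{- For every $0<\varepsilon<1$ there exists $\Theta=\Theta(\varepsilon)>0$, depending on $\varepsilon$ only, such that for every prime power $q$, all $m,n$, every matrix $A\in\mathbb F_q^{m\times n}$ and every nonempty $U\subset[n]$ the following holds. Draw $\boldsymbol\theta\in[\Theta]$ uniformly at random and then $(\mathbf i_1,\dots,\mathbf i_{\boldsymbol\theta})\in U^{\boldsymbol\theta}$ uniformly at random, and let $\hat A=A[\mathbf i_1,\dots,\mathbf i_{\boldsymbol\theta}]$. Then $$\mathbb P\left[\mu_{\hat A,U}\text{ is }\varepsilon\text{ -symmetric}\right]>1-\varepsilon.$$
   Context: For $A\in\mathbb F_q^{m\times n}$, the Boltzmann distribution $\mu_A$ is the uniform distribution on $\ker(A)\subset\mathbb F_q^n$. For $J\subset[n]$, $\mu_{A,J}$ denotes the marginal distribution of $\mu_A$ on the coordinates in $J$; for $i,j\in[n]$, $\mu_{A,i}$ and $\mu_{A,i,j}$ are the one- and two-coordinate marginals. For $i_1,\dots,i_\ell\in[n]$, $A[i_1,\dots,i_\ell]$ is the matrix obtained from $A$ by appending, for each $j\in[\ell]$, a row with entry $1$ in column $i_j$ and zeros elsewhere. A distribution $\mu$ on $\mathbb F_q^{U}$ is $\varepsilon$-symmetric if $\sum_{u,v\in U}d_{TV}(\mu_{u,v},\mu_u\otimes\mu_v)<\varepsilon|U|^2$, where $\mu_u,\mu_{u,v}$ are its marginals and $d_{TV}$ is total variation distance.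
   Formalization: The parameter ε ranges over the rationals with $0<\varepsilon<1$. -}

module Defs where

open import Data.Nat as ℕ using (ℕ; zero; suc)
open import Data.Integer using (+_)
open import Data.Fin as Fin using (Fin)
open import Data.Sum using (inj₁; inj₂)
open import Data.Rational.Properties as ℚP using ()
import Data.List as List
open import Data.Fin.Subset using (Subset; _∈_; Nonempty)
open import Data.Fin.Subset.Properties using (_∈?_)
open import Data.List using (List; []; _∷_; map; concatMap; length; filter; allFin; sum; foldr)
open import Data.Vec.Functional as VF using (Vector)
open import Data.Bool using (Bool; true; false; if_then_else_)
open import Data.Product using (Σ; _×_; _,_; ∃)
open import Data.Rational as ℚ using (ℚ; 0ℚ; 1ℚ; _/_; ∣_∣)
open import Relation.Binary.PropositionalEquality using (_≡_)
open import Relation.Binary.Definitions using (DecidableEquality)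
open import Relation.Nullary using (¬_; does)
open import Algebra.Structures using (IsCommutativeRing)
open import Function.Bundles using (_↔_; Inverse)

-- Finite fields: a field (with propositional equality) whose carrier
-- has decidable equality and is in bijection with Fin q.
-- (Every finite field has prime-power order q, and every prime power
-- q arises; quantifying over all finite fields = over all F_q.)

record FiniteField : Set₁ where
  field
    Carrier : Set
    _+F_ _*F_ : Carrier → Carrier → Carrier
    -F_ : Carrier → Carrier
    0F 1F : Carrier
    isCommRing : IsCommutativeRing {A = Carrier} _≡_ _+F_ _*F_ -F_ 0F 1F
    0≢1 : ¬ (0F ≡ 1F)
    inverse : ∀ x → ¬ (x ≡ 0F) → ∃ λ y → (x *F y) ≡ 1F
    _≟F_ : DecidableEquality Carrier
    order : ℕ
    enum : Fin order ↔ Carrier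

module _ (F : FiniteField) where
  open FiniteField F

  elems : List Carrier
  elems = map (Inverse.to enum) (allFin order)

  allVecs : (n : ℕ) → List (Vector Carrier n)
  allVecs zero    = (λ ()) ∷ []
  allVecs (suc n) = concatMap (λ a → map (a VF.∷_) (allVecs n)) elems

  Matrix : ℕ → ℕ → Set
  Matrix m n = Fin m → Fin n → Carrier

  sumF : ∀ {n} → Vector Carrier n → Carrier
  sumF = VF.foldr _+F_ 0F

  isZeroVec : ∀ {m} → Vector Carrier m → Bool
  isZeroVec {m} v = foldr (λ i b → does (v i ≟F 0F) Data.Bool.∧ b) true (allFin m)

  inKer : ∀ {m n} → Matrix m n → Vector Carrier n → Bool
  inKer A x = isZeroVec (λ i → sumF (λ j → A i j *F x j))

  kernel : ∀ {m n} → Matrix m n → List (Vector Carrier n)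
  kernel {n = n} A = filter (λ x → inKer A x Data.Bool.≟ true) (allVecs n)

  count : ∀ {X : Set} → (X → Bool) → List X → ℕ
  count p xs = length (filter (λ x → p x Data.Bool.≟ true) xs)

  -- a / b as a rational (b = 0 gives 0; never used with b = 0 here)
  _÷ℕ_ : ℕ → ℕ → ℚ
  a ÷ℕ zero  = 0ℚ
  a ÷ℕ suc b = (+ a) / suc b

  μ : ∀ {m n} → Matrix m n → Vector Carrier n → ℚ
  μ A x = (if inKer A x then 1 else 0) ÷ℕ length (kernel A)

  μ₁ : ∀ {m n} → Matrix m n → Fin n → Carrier → ℚ
  μ₁ A i a = count (λ x → does (x i ≟F a)) (kernel A) ÷ℕ length (kernel A)

  μ₂ : ∀ {m n} → Matrix m n → Fin n → Fin n → Carrier → Carrier → ℚ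
  μ₂ A i j a b =
    count (λ x → does (x i ≟F a) Data.Bool.∧ does (x j ≟F b)) (kernel A)
      ÷ℕ length (kernel A)

  dTV-pair : ∀ {m n} → Matrix m n → Fin n → Fin n → ℚ
  dTV-pair A u v =
    (+ 1 / 2) ℚ.* foldr ℚ._+_ 0ℚ (concatMap (λ a → map (λ b →
        ∣ μ₂ A u v a b ℚ.- (μ₁ A u a ℚ.* μ₁ A v b) ∣) elems) elems)

  elemsOf : ∀ {n} → Subset n → List (Fin n)
  elemsOf {n} U = filter (_∈? U) (allFin n)

  sumℚ : List ℚ → ℚ
  sumℚ = foldr ℚ._+_ 0ℚ

  -- μ_{A,U} is ε-symmetric.  The one- and two-coordinate marginals of
  -- μ_{A,U} at u, v ∈ U are exactly μ_{A,u}, μ_{A,u,v}.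
  symLHS symRHS : ∀ {m n} → ℚ → Matrix m n → Subset n → ℚ
  symLHS ε A U =
    sumℚ (concatMap (λ u → map (λ v → dTV-pair A u v) (elemsOf U)) (elemsOf U))
  symRHS ε A U = ε ℚ.* ((+ length (elemsOf U)) / 1 ℚ.* ((+ length (elemsOf U)) / 1))

  symmetric? : ∀ {m n} → (ε : ℚ) → (A : Matrix m n) → (U : Subset n) → Bool
  symmetric? ε A U = does (symLHS ε A U ℚP.<? symRHS ε A U)

  pin : ∀ {m n} → Matrix m n → (is : List (Fin n)) → Matrix (m ℕ.+ length is) n
  pin {m} A is r j with Fin.splitAt m r
  ... | inj₁ r′ = A r′ j
  ... | inj₂ k  = if does (List.lookup is k Fin.≟ j) then 1F else 0F

  tuples : ∀ {n} → Subset n → ℕ → List (List (Fin n))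
  tuples U zero    = [] ∷ []
  tuples U (suc θ) = concatMap (λ i → map (i ∷_) (tuples U θ)) (elemsOf U)

  -- P[ μ_{Â,U} is ε-symmetric ], θ uniform in [Θ] = {1,…,Θ},
  -- (i₁,…,i_θ) uniform in U^θ, Â = A[i₁,…,i_θ]
  probSym : ∀ {m n} → ℕ → ℚ → Matrix m n → Subset n → ℚ
  probSym Θ ε A U =
    sumℚ (map (λ θ → (count (λ is → symmetric? ε (pin A is) U) (tuples U θ))
                      ÷ℕ (length (elemsOf U) ℕ.^ θ))
              (List.map ℕ.suc (List.upTo Θ)))
      ℚ.* (1 ÷ℕ Θ)

-- A coordinate v is frozen if every kernel vector vanishes at v, and u forces v if v is not frozen
-- but every kernel vector vanishing at u vanishes at v. Unless u forces v, the coordinates x_u, x_v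
-- of a uniform kernel vector are exactly independent: this is trivial if u or v is frozen, and
-- otherwise (x_u, x_v) takes every value in F² equally often, by translating with kernel vectors.
-- So if μ_{A,U} is not ε-symmetric, at least ε|U|² pairs in U are forcing.
-- Pinning u freezes every v forced by u, and frozen coordinates stay frozen. Hence the expected
-- number of unfrozen coordinates in U, which lies in [0, |U|], drops by at least ε|U| in every
-- round of pinning a uniform coordinate of U that starts from an asymmetric μ; so the
-- probabilities of asymmetry after θ = 1, 2, … pinnings sum to at most 1/ε. Writing ε = p/d,
-- the choice Θ = d² + 1 makes their average over θ ≤ Θ smaller than ε.

module Submission where

open import Defs
open import Algebra.Bundles using (CommutativeMonoid; CommutativeRing)
open import Algebra.Structures using (IsCommutativeRing)
import Algebra.Properties.CommutativeMonoid.Sum as CommutativeMonoidSum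
import Algebra.Properties.Group as GroupProperties
import Algebra.Properties.Ring as RingProperties
import Algebra.Properties.Semiring.Sum as SemiringSum
open import Data.Bool using (Bool; true; false; not; _∧_; if_then_else_)
import Data.Bool as Bool
open import Data.Bool.Properties using (⇔→≡; ∧-comm)
open import Data.Empty using (⊥-elim)
open import Data.Fin as Fin using (Fin; _↑ˡ_; _↑ʳ_)
import Data.Fin.Properties as Fin
open import Data.Fin.Permutation using (Permutation; permutation)
open import Data.Fin.Subset using (Subset; Nonempty)
open import Data.Fin.Subset.Properties using (_∈?_)
import Data.Integer as ℤ
import Data.Integer.Properties as ℤ
open import Data.List using (List; []; _∷_; _++_; map; concatMap; filter; foldr; length; allFin; upTo)
import Data.List as List
import Data.List.Properties as List
open import Data.List.Membership.Propositional using (_∈_; find)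
open import Data.List.Membership.Propositional.Properties
  using (∈-allFin; ∈-filter⁻; ∈-filter⁺; ∈-map⁺; ∈-concatMap⁺; ∈-length)
open import Data.List.Relation.Unary.All as All using (All)
open import Data.List.Relation.Unary.All.Properties using (¬All⇒Any¬)
open import Data.List.Relation.Unary.Any as Any using (here; there)
open import Data.Nat as ℕ using (ℕ; zero; suc; _+_; _*_; _^_; _∸_; _≤_; _≥_)
import Data.Nat.Properties as ℕ
open import Data.Nat.Tactic.RingSolver using (solve-∀)
open import Data.Product using (Σ; ∃; _×_; _,_; proj₁; proj₂)
open import Data.Rational as ℚ using (ℚ; 0ℚ; 1ℚ; _<_; _-_)
import Data.Rational.Properties as ℚ
open import Data.Sum using (inj₁; inj₂)
open import Data.Vec.Functional as VF using (Vector)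
open import Function using (_∘_; id; const)
open import Function.Bundles using (Inverse; mk⇔)
open import Relation.Binary.PropositionalEquality
open import Relation.Nullary using (Dec; yes; no; does; ¬_; ¬?; _×-dec_; _→-dec_)
open import Relation.Nullary.Decidable using (dec-true; dec-false)

-- Sums over lists

module ListSum {c ℓ} (M : CommutativeMonoid c ℓ) where
  open CommutativeMonoid M
    using (_≈_; _∙_; ε; ∙-cong; ∙-congˡ; assoc; identityˡ)
    renaming (Carrier to R; refl to ≈-refl; sym to ≈-sym; trans to ≈-trans; reflexive to ≈-reflexive)
  open import Algebra.Properties.CommutativeSemigroup (CommutativeMonoid.commutativeSemigroup M) using (interchange)
  open import Relation.Binary.Reasoning.Setoid (CommutativeMonoid.setoid M)

  private variable A B : Set

  -- A fold of map f, so that the sums over lists in Defs are instances of ∑ by definition.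
  ∑ : List A → (A → R) → R
  ∑ xs f = foldr _∙_ ε (map f xs)

  ∑-cong-∈ : ∀ xs {f g : A → R} → (∀ {x} → x ∈ xs → f x ≈ g x) → ∑ xs f ≈ ∑ xs g
  ∑-cong-∈ []       f≈g = ≈-refl
  ∑-cong-∈ (x ∷ xs) f≈g = ∙-cong (f≈g (here refl)) (∑-cong-∈ xs (f≈g ∘ there))

  ∑-cong : ∀ xs {f g : A → R} → (∀ x → f x ≈ g x) → ∑ xs f ≈ ∑ xs g
  ∑-cong xs f≈g = ∑-cong-∈ xs (λ {x} _ → f≈g x)

  ∑-ε : ∀ (xs : List A) → ∑ xs (λ _ → ε) ≈ ε
  ∑-ε []       = ≈-refl
  ∑-ε (x ∷ xs) = ≈-trans (identityˡ _) (∑-ε xs)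

  foldr-++ : ∀ (xs ys : List R) → foldr _∙_ ε (xs ++ ys) ≈ foldr _∙_ ε xs ∙ foldr _∙_ ε ys
  foldr-++ []       ys = ≈-sym (identityˡ _)
  foldr-++ (x ∷ xs) ys = ≈-trans (∙-congˡ (foldr-++ xs ys)) (≈-sym (assoc _ _ _))

  ∑-++ : ∀ xs ys (f : A → R) → ∑ (xs ++ ys) f ≈ ∑ xs f ∙ ∑ ys f
  ∑-++ xs ys f = ≈-trans (≈-reflexive (cong (foldr _∙_ ε) (List.map-++ f xs ys))) (foldr-++ (map f xs) (map f ys))

  ∑-∙ : ∀ xs (f g : A → R) → ∑ xs (λ x → f x ∙ g x) ≈ ∑ xs f ∙ ∑ xs g
  ∑-∙ []       f g = ≈-sym (identityˡ ε)
  ∑-∙ (x ∷ xs) f g = ≈-trans (∙-congˡ (∑-∙ xs f g)) (interchange (f x) (g x) (∑ xs f) (∑ xs g))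

  ∑-map : ∀ (g : A → B) xs (f : B → R) → ∑ (map g xs) f ≈ ∑ xs (f ∘ g)
  ∑-map g xs f = ≈-reflexive (cong (foldr _∙_ ε) (sym (List.map-∘ xs)))

  ∑-concatMap : ∀ (h : A → List B) xs (f : B → R) →
                ∑ (concatMap h xs) f ≈ ∑ xs (λ x → ∑ (h x) f)
  ∑-concatMap h []       f = ≈-refl
  ∑-concatMap h (x ∷ xs) f = ≈-trans (∑-++ (h x) (concatMap h xs) f) (∙-congˡ (∑-concatMap h xs f))

  foldr-concatMap-map : ∀ xs (ys : List B) (f : A → B → R) →
                        foldr _∙_ ε (concatMap (λ x → map (f x) ys) xs) ≈ ∑ xs (λ x → ∑ ys (f x))
  foldr-concatMap-map []       ys f = ≈-refl
  foldr-concatMap-map (x ∷ xs) ys f =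
    ≈-trans (foldr-++ (map (f x) ys) _) (∙-congˡ (foldr-concatMap-map xs ys f))

  ∑-filter : ∀ (p : A → Bool) xs (f : A → R) →
             ∑ (filter (λ x → p x Bool.≟ true) xs) f ≈ ∑ xs (λ x → if p x then f x else ε)
  ∑-filter p []       f = ≈-refl
  ∑-filter p (x ∷ xs) f with p x
  ... | true  = ∙-congˡ (∑-filter p xs f)
  ... | false = ≈-trans (∑-filter p xs f) (≈-sym (identityˡ _))

  ∑-comm : ∀ xs (ys : List B) (f : A → B → R) →
           ∑ xs (λ x → ∑ ys (f x)) ≈ ∑ ys (λ y → ∑ xs (λ x → f x y))
  ∑-comm []       ys f = ≈-sym (∑-ε ys)
  ∑-comm (x ∷ xs) ys f = begin
    ∑ ys (f x) ∙ ∑ xs (λ x → ∑ ys (f x))          ≈⟨ ∙-congˡ (∑-comm xs ys f) ⟩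
    ∑ ys (f x) ∙ ∑ ys (λ y → ∑ xs (λ x → f x y)) ≈⟨ ≈-sym (∑-∙ ys (f x) _) ⟩
    ∑ ys (λ y → f x y ∙ ∑ xs (λ x → f x y))      ∎

module _ {c ℓ} (M : CommutativeMonoid c ℓ) where
  open CommutativeMonoid M using (Carrier; _≈_; ε; ∙-congˡ; identityʳ) renaming (trans to ≈-trans)
  open CommutativeMonoidSum M using (sum; sum-remove; sum-cong-≋; sum-replicate-zero)

  sum-supported-at : ∀ {n} (i : Fin (suc n)) (t : Vector Carrier (suc n)) →
                     (∀ j → t (Fin.punchIn i j) ≈ ε) → sum t ≈ t i
  sum-supported-at {n} i t t≈ε = ≈-trans (sum-remove {i = i} t)
    (≈-trans (∙-congˡ (≈-trans (sum-cong-≋ t≈ε) (sum-replicate-zero n))) (identityʳ (t i)))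

open ListSum ℕ.+-0-commutativeMonoid
module ℚΣ = ListSum ℚ.+-0-commutativeMonoid

private variable A : Set

indicator : Bool → ℕ
indicator b = if b then 1 else 0

indicator≤1 : ∀ b → indicator b ≤ 1
indicator≤1 true  = ℕ.≤-refl
indicator≤1 false = ℕ.z≤n

∑-const : ∀ (xs : List A) c → ∑ xs (λ _ → c) ≡ length xs * c
∑-const []       c = refl
∑-const (x ∷ xs) c = cong (c +_) (∑-const xs c)

∑-1 : ∀ (xs : List A) → ∑ xs (λ _ → 1) ≡ length xs
∑-1 xs = trans (∑-const xs 1) (ℕ.*-identityʳ (length xs))

∑-*ˡ : ∀ c xs (f : A → ℕ) → ∑ xs (λ x → c * f x) ≡ c * ∑ xs f
∑-*ˡ c []       f = sym (ℕ.*-zeroʳ c)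
∑-*ˡ c (x ∷ xs) f = trans (cong (c * f x +_) (∑-*ˡ c xs f)) (sym (ℕ.*-distribˡ-+ c (f x) _))

∑-*ʳ : ∀ c xs (f : A → ℕ) → ∑ xs (λ x → f x * c) ≡ ∑ xs f * c
∑-*ʳ c xs f = trans (∑-cong xs (λ x → ℕ.*-comm (f x) c)) (trans (∑-*ˡ c xs f) (ℕ.*-comm c (∑ xs f)))

∑-*-∑ : ∀ {B : Set} xs (ys : List B) (f : A → ℕ) (g : B → ℕ) →
        ∑ xs (λ x → ∑ ys (λ y → f x * g y)) ≡ ∑ xs f * ∑ ys g
∑-*-∑ xs ys f g = trans (∑-cong xs (λ x → ∑-*ˡ (f x) ys g)) (∑-*ʳ (∑ ys g) xs f)

∑-mono-≤ : ∀ xs {f g : A → ℕ} → (∀ x → f x ≤ g x) → ∑ xs f ≤ ∑ xs g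
∑-mono-≤ []       f≤g = ℕ.z≤n
∑-mono-≤ (x ∷ xs) f≤g = ℕ.+-mono-≤ (f≤g x) (∑-mono-≤ xs f≤g)

length-filter≡∑ : ∀ (p : A → Bool) xs →
                  length (filter (λ x → p x Bool.≟ true) xs) ≡ ∑ xs (indicator ∘ p)
length-filter≡∑ p xs = trans (sym (∑-1 (filter _ xs))) (∑-filter p xs (λ _ → 1))

∑-indicator-∧-const : ∀ (p q : A → Bool) {b} xs → (∀ {x} → x ∈ xs → p x ≡ b) →
                      ∑ xs (λ x → indicator (p x ∧ q x)) * length xs ≡
                      ∑ xs (indicator ∘ p) * ∑ xs (indicator ∘ q)
∑-indicator-∧-const p q {true} xs p≡b = begin
  ∑ xs (λ x → indicator (p x ∧ q x)) * length xs ≡⟨ cong (_* length xs) ∑p∧q≡∑q ⟩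
  ∑ xs (indicator ∘ q) * length xs                ≡⟨ ℕ.*-comm _ (length xs) ⟩
  length xs * ∑ xs (indicator ∘ q)                ≡⟨ cong (_* ∑ xs (indicator ∘ q)) ∑p≡length ⟨
  ∑ xs (indicator ∘ p) * ∑ xs (indicator ∘ q)     ∎
  where
  open ≡-Reasoning
  ∑p∧q≡∑q : ∑ xs (λ x → indicator (p x ∧ q x)) ≡ ∑ xs (indicator ∘ q)
  ∑p∧q≡∑q = ∑-cong-∈ xs (cong (λ c → indicator (c ∧ _)) ∘ p≡b)
  ∑p≡length : ∑ xs (indicator ∘ p) ≡ length xs
  ∑p≡length = trans (∑-cong-∈ xs (cong indicator ∘ p≡b)) (∑-1 xs)
∑-indicator-∧-const p q {false} xs p≡b = begin
  ∑ xs (λ x → indicator (p x ∧ q x)) * length xs ≡⟨ cong (_* length xs) ∑p∧q≡0 ⟩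
  0                                               ≡⟨ cong (_* ∑ xs (indicator ∘ q)) ∑p≡0 ⟨
  ∑ xs (indicator ∘ p) * ∑ xs (indicator ∘ q)     ∎
  where
  open ≡-Reasoning
  ∑p∧q≡0 : ∑ xs (λ x → indicator (p x ∧ q x)) ≡ 0
  ∑p∧q≡0 = trans (∑-cong-∈ xs (cong (λ c → indicator (c ∧ _)) ∘ p≡b)) (∑-ε xs)
  ∑p≡0 : ∑ xs (indicator ∘ p) ≡ 0
  ∑p≡0 = trans (∑-cong-∈ xs (cong indicator ∘ p≡b)) (∑-ε xs)

module FinSum = CommutativeMonoidSum ℕ.+-0-commutativeMonoid

∑-allFin : ∀ {k} (h : Fin k → ℕ) → ∑ (allFin k) h ≡ FinSum.sum h
∑-allFin {zero}  h = refl
∑-allFin {suc k} h = cong (h Fin.zero +_) (begin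
  ∑ (List.tabulate Fin.suc) h        ≡⟨ cong (λ is → ∑ is h) (List.map-tabulate id Fin.suc) ⟨
  ∑ (map Fin.suc (allFin k)) h       ≡⟨ ∑-map Fin.suc (allFin k) h ⟩
  ∑ (allFin k) (h ∘ Fin.suc)         ≡⟨ ∑-allFin (h ∘ Fin.suc) ⟩
  FinSum.sum (h ∘ Fin.suc)           ∎)
  where open ≡-Reasoning

sum-δ : ∀ {k} (i : Fin k) → FinSum.sum (λ j → indicator (does (i Fin.≟ j))) ≡ 1
sum-δ {suc k} i = trans (sum-supported-at ℕ.+-0-commutativeMonoid i (λ j → indicator (does (i Fin.≟ j))) δ-punchIn)
                        (cong indicator (dec-true (i Fin.≟ i) refl))
  where
  δ-punchIn : ∀ j → indicator (does (i Fin.≟ Fin.punchIn i j)) ≡ 0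
  δ-punchIn j = cong indicator (dec-false (i Fin.≟ _) (Fin.punchInᵢ≢i i j ∘ sym))

infix 8 _/suc_

_/suc_ : ℕ → ℕ → ℚ
a /suc k = ℤ.+ a ℚ./ suc k

module _ where
  open import Data.Rational.Unnormalised as ℚᵘ using (ℚᵘ; mkℚᵘ; _≃_; *≡*; *≤*; *<*)
  import Data.Rational.Unnormalised.Properties as ℚᵘ
  open ℚᵘ.≤-Reasoning

  private
    ᵘ : ℕ → ℕ → ℚᵘ
    ᵘ a k = mkℚᵘ (ℤ.+ a) k

    toℚᵘ-/suc : ∀ a k → ℚ.toℚᵘ (a /suc k) ≃ ᵘ a k
    toℚᵘ-/suc a k = ℚ.toℚᵘ-fromℚᵘ (ᵘ a k)

    +·+ : ∀ a b → ℤ.+ a ℤ.* ℤ.+ b ≡ ℤ.+ (a * b)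
    +·+ a b = sym (ℤ.pos-* a b)

    ᵘ-≃ : ∀ {a k b l} → a * suc l ≡ b * suc k → ᵘ a k ≃ ᵘ b l
    ᵘ-≃ {a} {k} {b} {l} eq = *≡* (trans (+·+ a (suc l)) (trans (cong ℤ.+_ eq) (sym (+·+ b (suc k)))))

    ᵘ-+ : ∀ a b k → ᵘ a k ℚᵘ.+ ᵘ b k ≃ ᵘ (a + b) k
    ᵘ-+ a b k = ℚᵘ.≃-trans
      (ℚᵘ.≃-reflexive (cong (λ z → mkℚᵘ z (k + k * suc k))
        (trans (cong₂ ℤ._+_ (+·+ a (suc k)) (+·+ b (suc k))) (sym (ℤ.pos-+ (a * suc k) (b * suc k))))))
      (ᵘ-≃ (trans (cong (_* suc k) (sym (ℕ.*-distribʳ-+ (suc k) a b))) (ℕ.*-assoc (a + b) (suc k) (suc k))))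

  /suc-cong : ∀ {a k b l} → a * suc l ≡ b * suc k → a /suc k ≡ b /suc l
  /suc-cong {a} {k} {b} {l} eq = ℚ.fromℚᵘ-cong {ᵘ a k} {ᵘ b l} (ᵘ-≃ eq)

  /suc-mono-≤ : ∀ {a k b l} → a * suc l ≤ b * suc k → a /suc k ℚ.≤ b /suc l
  /suc-mono-≤ {a} {k} {b} {l} le = ℚ.toℚᵘ-cancel-≤
    (ℚᵘ.≤-respˡ-≃ (ℚᵘ.≃-sym (toℚᵘ-/suc a k)) (ℚᵘ.≤-respʳ-≃ (ℚᵘ.≃-sym (toℚᵘ-/suc b l))
      (*≤* (subst₂ ℤ._≤_ (sym (+·+ a (suc l))) (sym (+·+ b (suc k))) (ℤ.+≤+ le)))))

  /suc-cancel-≤ : ∀ {a k b l} → a /suc k ℚ.≤ b /suc l → a * suc l ≤ b * suc k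
  /suc-cancel-≤ {a} {k} {b} {l} le
    with ℚᵘ.≤-respˡ-≃ (toℚᵘ-/suc a k) (ℚᵘ.≤-respʳ-≃ (toℚᵘ-/suc b l) (ℚ.toℚᵘ-mono-≤ le))
  ... | *≤* le′ with subst₂ ℤ._≤_ (+·+ a (suc l)) (+·+ b (suc k)) le′
  ...   | ℤ.+≤+ le″ = le″

  /suc-mono-< : ∀ {a k b l} → a * suc l ℕ.< b * suc k → a /suc k ℚ.< b /suc l
  /suc-mono-< {a} {k} {b} {l} lt = ℚ.toℚᵘ-cancel-<
    (ℚᵘ.<-respˡ-≃ (ℚᵘ.≃-sym (toℚᵘ-/suc a k)) (ℚᵘ.<-respʳ-≃ (ℚᵘ.≃-sym (toℚᵘ-/suc b l))
      (*<* (subst₂ ℤ._<_ (sym (+·+ a (suc l))) (sym (+·+ b (suc k))) (ℤ.+<+ lt)))))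

  /suc-* : ∀ a k b l → a /suc k ℚ.* b /suc l ≡ (a * b) /suc (l + k * suc l)
  /suc-* a k b l = ℚ.toℚᵘ-injective (begin-equality
    ℚ.toℚᵘ (a /suc k ℚ.* b /suc l)           ≃⟨ ℚ.toℚᵘ-homo-* (a /suc k) (b /suc l) ⟩
    ℚ.toℚᵘ (a /suc k) ℚᵘ.* ℚ.toℚᵘ (b /suc l) ≃⟨ ℚᵘ.*-cong (toℚᵘ-/suc a k) (toℚᵘ-/suc b l) ⟩
    ᵘ a k ℚᵘ.* ᵘ b l                         ≃⟨ ℚᵘ.≃-reflexive (cong (λ z → mkℚᵘ z _) (+·+ a b)) ⟩
    ᵘ (a * b) (l + k * suc l)                ≃⟨ toℚᵘ-/suc (a * b) (l + k * suc l) ⟨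
    ℚ.toℚᵘ ((a * b) /suc (l + k * suc l))    ∎)

  /suc-+ : ∀ a b k → a /suc k ℚ.+ b /suc k ≡ (a + b) /suc k
  /suc-+ a b k = ℚ.toℚᵘ-injective (begin-equality
    ℚ.toℚᵘ (a /suc k ℚ.+ b /suc k)           ≃⟨ ℚ.toℚᵘ-homo-+ (a /suc k) (b /suc k) ⟩
    ℚ.toℚᵘ (a /suc k) ℚᵘ.+ ℚ.toℚᵘ (b /suc k) ≃⟨ ℚᵘ.+-cong (toℚᵘ-/suc a k) (toℚᵘ-/suc b k) ⟩
    ᵘ a k ℚᵘ.+ ᵘ b k                         ≃⟨ ᵘ-+ a b k ⟩
    ᵘ (a + b) k                              ≃⟨ toℚᵘ-/suc (a + b) k ⟨
    ℚ.toℚᵘ ((a + b) /suc k)                  ∎)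

0≤/suc : ∀ a k → 0ℚ ℚ.≤ a /suc k
0≤/suc a k = /suc-mono-≤ {0} {0} {a} {k} ℕ.z≤n

0/suc : ∀ k → 0 /suc k ≡ 0ℚ
0/suc k = /suc-cong {0} {k} {0} {0} refl

1-/suc : ∀ {p dm} → p ≤ suc dm → 1ℚ ℚ.- p /suc dm ≡ (suc dm ∸ p) /suc dm
1-/suc {p} {dm} p≤d = begin
  1ℚ ℚ.- ε                          ≡⟨ cong (ℚ._- ε) (/suc-cong {1} {0} {suc dm} {dm} (ℕ.*-comm 1 (suc dm))) ⟩
  suc dm /suc dm ℚ.- ε              ≡⟨ cong (λ a → a /suc dm ℚ.- ε) (ℕ.m∸n+n≡m p≤d) ⟨
  (d∸p + p) /suc dm ℚ.- ε           ≡⟨ cong (ℚ._- ε) (/suc-+ d∸p p dm) ⟨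
  (d∸p /suc dm ℚ.+ ε) ℚ.- ε         ≡⟨ ℚ.+-assoc (d∸p /suc dm) ε (ℚ.- ε) ⟩
  d∸p /suc dm ℚ.+ (ε ℚ.- ε)         ≡⟨ cong (d∸p /suc dm ℚ.+_) (ℚ.+-inverseʳ ε) ⟩
  d∸p /suc dm ℚ.+ 0ℚ                ≡⟨ ℚ.+-identityʳ (d∸p /suc dm) ⟩
  d∸p /suc dm                       ∎
  where
  open ≡-Reasoning
  ε = p /suc dm
  d∸p = suc dm ∸ p

∑-/suc : ∀ xs (f : A → ℕ) k → ℚΣ.∑ xs (λ x → f x /suc k) ≡ ∑ xs f /suc k
∑-/suc []       f k = sym (0/suc k)
∑-/suc (x ∷ xs) f k = trans (cong (f x /suc k ℚ.+_) (∑-/suc xs f k)) (/suc-+ (f x) (∑ xs f) k)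

∑∑-/suc : ∀ {B : Set} xs (ys : List B) (f : A → B → ℕ) k →
          ℚΣ.∑ xs (λ x → ℚΣ.∑ ys (λ y → f x y /suc k)) ≡ ∑ xs (λ x → ∑ ys (f x)) /suc k
∑∑-/suc xs ys f k = trans (ℚΣ.∑-cong xs (λ x → ∑-/suc ys (f x) k)) (∑-/suc xs (λ x → ∑ ys (f x)) k)

ℚ∑-mono-≤ : ∀ xs {f g : A → ℚ} → (∀ x → f x ℚ.≤ g x) → ℚΣ.∑ xs f ℚ.≤ ℚΣ.∑ xs g
ℚ∑-mono-≤ []       f≤g = ℚ.≤-refl
ℚ∑-mono-≤ (x ∷ xs) f≤g = ℚ.+-mono-≤ (f≤g x) (ℚ∑-mono-≤ xs f≤g)

½ : ℚ
½ = 1 /suc 1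

∣p-q∣≤p+q : ∀ p q → 0ℚ ℚ.≤ p → 0ℚ ℚ.≤ q → ℚ.∣ p ℚ.- q ∣ ℚ.≤ p ℚ.+ q
∣p-q∣≤p+q p q 0≤p 0≤q = ℚ.≤-trans (ℚ.∣p+q∣≤∣p∣+∣q∣ p (ℚ.- q))
  (ℚ.≤-reflexive (cong₂ ℚ._+_ (ℚ.0≤p⇒∣p∣≡p 0≤p) (trans (ℚ.∣-p∣≡∣p∣ q) (ℚ.0≤p⇒∣p∣≡p 0≤q))))

½∑∑∣-∣≤1 : ∀ {X Y : Set} xs ys (P Q : X → Y → ℚ) →
           (∀ x y → 0ℚ ℚ.≤ P x y) → (∀ x y → 0ℚ ℚ.≤ Q x y) →
           ℚΣ.∑ xs (λ x → ℚΣ.∑ ys (P x)) ≡ 1ℚ → ℚΣ.∑ xs (λ x → ℚΣ.∑ ys (Q x)) ≡ 1ℚ →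
           ½ ℚ.* ℚΣ.∑ xs (λ x → ℚΣ.∑ ys (λ y → ℚ.∣ P x y ℚ.- Q x y ∣)) ℚ.≤ 1ℚ
½∑∑∣-∣≤1 xs ys P Q 0≤P 0≤Q ∑P≡1 ∑Q≡1 = begin
  ½ ℚ.* ℚΣ.∑ xs (λ x → ℚΣ.∑ ys (λ y → ℚ.∣ P x y ℚ.- Q x y ∣))
    ≤⟨ ℚ.*-monoˡ-≤-nonNeg ½ (ℚ∑-mono-≤ xs (λ x → ℚ∑-mono-≤ ys (λ y →
         ∣p-q∣≤p+q (P x y) (Q x y) (0≤P x y) (0≤Q x y)))) ⟩
  ½ ℚ.* ℚΣ.∑ xs (λ x → ℚΣ.∑ ys (λ y → P x y ℚ.+ Q x y))
    ≡⟨ cong (½ ℚ.*_) (trans (ℚΣ.∑-cong xs (λ x → ℚΣ.∑-∙ ys (P x) (Q x))) (ℚΣ.∑-∙ xs _ _)) ⟩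
  ½ ℚ.* (ℚΣ.∑ xs (λ x → ℚΣ.∑ ys (P x)) ℚ.+ ℚΣ.∑ xs (λ x → ℚΣ.∑ ys (Q x)))
    ≡⟨ cong (½ ℚ.*_) (cong₂ ℚ._+_ ∑P≡1 ∑Q≡1) ⟩
  ½ ℚ.* (1ℚ ℚ.+ 1ℚ)
    ≡⟨⟩
  1ℚ ∎
  where open ℚ.≤-Reasoning

≤-indicator : ∀ {P : Set} (P? : Dec P) {q} → (¬ P → q ≡ 0ℚ) → q ℚ.≤ 1ℚ →
              q ℚ.≤ indicator (does P?) /suc 0
≤-indicator (yes _)  _      q≤1 = q≤1
≤-indicator (no ¬p) ¬p⇒q≡0 _   = ℚ.≤-reflexive (¬p⇒q≡0 ¬p)

not-indicator-+-≤ : ∀ {P Q R : Set} (P? : Dec P) (Q? : Dec Q) (R? : Dec R) →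
                     (R → P) → (Q → P) → (Q → ¬ R) →
                     indicator (not (does P?)) + indicator (does Q?) ≤ indicator (not (does R?))
not-indicator-+-≤ (yes _) (no _)  _       _   _   _    = ℕ.z≤n
not-indicator-+-≤ _       (yes q) (yes r) _   _   q⇒¬r = ⊥-elim (q⇒¬r q r)
not-indicator-+-≤ (yes _) (yes _) (no _)  _   _   _    = ℕ.≤-refl
not-indicator-+-≤ (no ¬p) (yes q) (no _)  _   q⇒p _    = ⊥-elim (¬p (q⇒p q))
not-indicator-+-≤ (no _)  (no _)  (no _)  _   _   _    = ℕ.≤-refl
not-indicator-+-≤ (no ¬p) (no _)  (yes r) r⇒p _   _    = ⊥-elim (¬p (r⇒p r))

-- Weighted sums and the final estimate

-- horner s f t = ∑_{θ=1}^{t} f θ · s^(t∸θ), so that horner s f t / s^t = ∑_{θ=1}^{t} f θ / s^θ.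
horner : ℕ → (ℕ → ℕ) → ℕ → ℕ
horner s f zero    = 0
horner s f (suc t) = s * horner s f t + f (suc t)

horner-complement : ∀ s (f g : ℕ → ℕ) → (∀ θ → f (suc θ) + g (suc θ) ≡ s ^ suc θ) →
                    ∀ t → horner s f t + horner s g t ≡ t * s ^ t
horner-complement s f g f+g≡ zero    = refl
horner-complement s f g f+g≡ (suc t) = begin
  (s * horner s f t + f (suc t)) + (s * horner s g t + g (suc t))
    ≡⟨ regroup s (horner s f t) (f (suc t)) (horner s g t) (g (suc t)) ⟩
  s * (horner s f t + horner s g t) + (f (suc t) + g (suc t))
    ≡⟨ cong₂ (λ a b → s * a + b) (horner-complement s f g f+g≡ t) (f+g≡ t) ⟩
  s * (t * s ^ t) + s * s ^ t
    ≡⟨ collect s t (s ^ t) ⟩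
  suc t * s ^ suc t ∎
  where
  open ≡-Reasoning
  regroup : ∀ s x a y b → (s * x + a) + (s * y + b) ≡ s * (x + y) + (a + b)
  regroup = solve-∀
  collect : ∀ s t P → s * (t * P) + s * P ≡ suc t * (s * P)
  collect = solve-∀

horner-telescope : ∀ s a c (Φ B : ℕ → ℕ) →
                   (∀ θ → a * Φ (suc (suc θ)) + c * B (suc θ) ≤ a * s * Φ (suc θ)) →
                   ∀ t → c * horner s B t ≤ a * Φ 1 * s ^ t
horner-telescope s a c Φ B step t = ℕ.≤-trans (ℕ.m≤n+m _ (a * Φ (suc t))) (go t)
  where
  go : ∀ t → a * Φ (suc t) + c * horner s B t ≤ a * Φ 1 * s ^ t
  go zero    = ℕ.≤-reflexive (base (a * Φ 1) c)
    where
    base : ∀ x c → x + c * 0 ≡ x * 1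
    base = solve-∀
  go (suc t) = begin
    a * Φ (suc (suc t)) + c * (s * horner s B t + B (suc t))
      ≡⟨ regroup (a * Φ (suc (suc t))) c s (horner s B t) (B (suc t)) ⟩
    (a * Φ (suc (suc t)) + c * B (suc t)) + s * (c * horner s B t)
      ≤⟨ ℕ.+-monoˡ-≤ (s * (c * horner s B t)) (step t) ⟩
    a * s * Φ (suc t) + s * (c * horner s B t)
      ≡⟨ factor a s (Φ (suc t)) (c * horner s B t) ⟩
    s * (a * Φ (suc t) + c * horner s B t)
      ≤⟨ ℕ.*-monoʳ-≤ s (go t) ⟩
    s * (a * Φ 1 * s ^ t)
      ≡⟨ shuffle s (a * Φ 1) (s ^ t) ⟩
    a * Φ 1 * s ^ suc t ∎
    where
    open ℕ.≤-Reasoning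
    regroup : ∀ x c s h b → x + c * (s * h + b) ≡ (x + c * b) + s * (c * h)
    regroup = solve-∀
    factor : ∀ a s f r → a * s * f + s * r ≡ s * (a * f + r)
    factor = solve-∀
    shuffle : ∀ s x y → s * (x * y) ≡ x * (s * y)
    shuffle = solve-∀

complement-ratio-< : ∀ p d X Q S → 1 ≤ p → p ≤ d → 1 ≤ S →
                     X + Q ≡ suc (d * d) * S → p * Q ≤ d * S → (d ∸ p) * (S * suc (d * d)) ℕ.< X * d
complement-ratio-< p d X Q S 1≤p p≤d 1≤S X+Q≡ pQ≤dS = ℕ.+-cancelʳ-< (d * Q) _ _ (begin-strict
  (d ∸ p) * (S * Θ) + d * Q       <⟨ ℕ.+-monoʳ-< ((d ∸ p) * (S * Θ)) dQ<pΘS ⟩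
  (d ∸ p) * (S * Θ) + p * (Θ * S) ≡⟨ collect (d ∸ p) p S Θ ⟩
  (p + (d ∸ p)) * (Θ * S)         ≡⟨ cong (_* (Θ * S)) (ℕ.m+[n∸m]≡n p≤d) ⟩
  d * (Θ * S)                     ≡⟨ cong (d *_) (sym X+Q≡) ⟩
  d * (X + Q)                     ≡⟨ expand d X Q ⟩
  X * d + d * Q                   ∎)
  where
  open ℕ.≤-Reasoning
  Θ = suc (d * d)
  collect : ∀ e p S Θ → e * (S * Θ) + p * (Θ * S) ≡ (p + e) * (Θ * S)
  collect = solve-∀
  expand : ∀ d X Q → d * (X + Q) ≡ X * d + d * Q
  expand = solve-∀
  swap : ∀ p d Q → p * (d * Q) ≡ d * (p * Q)
  swap = solve-∀
  dQ<pΘS : d * Q ℕ.< p * (Θ * S)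
  dQ<pΘS = begin-strict
    d * Q       ≤⟨ ℕ.m≤n*m (d * Q) p {{ℕ.>-nonZero 1≤p}} ⟩
    p * (d * Q) ≡⟨ swap p d Q ⟩
    d * (p * Q) ≤⟨ ℕ.*-monoʳ-≤ d pQ≤dS ⟩
    d * (d * S) ≡⟨ sym (ℕ.*-assoc d d S) ⟩
    d * d * S   <⟨ ℕ.m<n+m (d * d * S) 1≤S ⟩
    Θ * S       ≤⟨ ℕ.m≤n*m (Θ * S) p {{ℕ.>-nonZero 1≤p}} ⟩
    p * (Θ * S) ∎

-- Kernels of matrices over a finite field

module _ (F : FiniteField) where
  open FiniteField F
  open IsCommutativeRing isCommRing
    using (+-identityˡ; +-identityʳ; *-assoc; *-comm; *-identityˡ; *-identityʳ; zeroˡ; zeroʳ; distribˡ)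

  private
    ringF : CommutativeRing _ _
    ringF = record { isCommutativeRing = isCommRing }

  open SemiringSum (CommutativeRing.semiring ringF) using (sum-cong-≗; sum-replicate-zero; ∑-distrib-+; *-distribˡ-sum)
  open GroupProperties (CommutativeRing.+-group ringF)
    using (∙-cancelʳ; \\-leftDividesˡ; //-rightDividesˡ; //-rightDividesʳ)

  infixl 6 _+ᵛ_
  infixr 7 _·ᵛ_
  infix 25 _⊙_

  _+ᵛ_ : ∀ {n} → Vector Carrier n → Vector Carrier n → Vector Carrier n
  (x +ᵛ y) j = x j +F y j

  _·ᵛ_ : ∀ {n} → Carrier → Vector Carrier n → Vector Carrier n
  (c ·ᵛ x) j = c *F x j

  _⊙_ : ∀ {n} → Vector Carrier n → Vector Carrier n → Carrier
  r ⊙ x = sumF F (λ j → r j *F x j)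

  ⊙-cong : ∀ {n} (r : Vector Carrier n) {x y} → x ≗ y → r ⊙ x ≡ r ⊙ y
  ⊙-cong r x≗y = sum-cong-≗ (λ j → cong (r j *F_) (x≗y j))

  ⊙-+ : ∀ {n} (r x y : Vector Carrier n) → r ⊙ (x +ᵛ y) ≡ r ⊙ x +F r ⊙ y
  ⊙-+ r x y = trans (sum-cong-≗ (λ j → distribˡ (r j) (x j) (y j)))
                    (∑-distrib-+ (λ j → r j *F x j) (λ j → r j *F y j))

  ⊙-· : ∀ {n} (r : Vector Carrier n) c x → r ⊙ (c ·ᵛ x) ≡ c *F r ⊙ x
  ⊙-· r c x = trans (sum-cong-≗ swap) (sym (*-distribˡ-sum c (λ j → r j *F x j)))
    where
    swap : ∀ j → r j *F (c *F x j) ≡ c *F (r j *F x j)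
    swap j = trans (sym (*-assoc (r j) c (x j))) (trans (cong (_*F x j) (*-comm (r j) c)) (*-assoc c (r j) (x j)))

  unit : ∀ {n} → Fin n → Vector Carrier n
  unit i j = if does (i Fin.≟ j) then 1F else 0F

  unit-⊙ : ∀ {n} (i : Fin n) x → unit i ⊙ x ≡ x i
  unit-⊙ {suc n} i x = begin
    unit i ⊙ x                                      ≡⟨ sum-supported-at (CommutativeRing.+-commutativeMonoid ringF) i
                                                         (λ j → unit i j *F x j) vanishes-off-i ⟩
    (if does (i Fin.≟ i) then 1F else 0F) *F x i  ≡⟨ cong (λ b → (if b then 1F else 0F) *F x i)
                                                         (dec-true (i Fin.≟ i) refl) ⟩
    1F *F x i                                       ≡⟨ *-identityˡ (x i) ⟩
    x i                                             ∎
    where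
    open ≡-Reasoning
    vanishes-off-i : ∀ j → unit i (Fin.punchIn i j) *F x (Fin.punchIn i j) ≡ 0F
    vanishes-off-i j = trans (cong (λ b → (if b then 1F else 0F) *F x (Fin.punchIn i j))
                                   (dec-false (i Fin.≟ _) (Fin.punchInᵢ≢i i j ∘ sym)))
                             (zeroˡ (x _))

  private
    allZero⁻ : ∀ {m} (v : Vector Carrier m) is →
               foldr (λ i b → does (v i ≟F 0F) ∧ b) true is ≡ true → ∀ {i} → i ∈ is → v i ≡ 0F
    allZero⁻ v (i ∷ is) h i∈ with v i ≟F 0F | i∈
    ... | yes vi≡0 | here refl = vi≡0
    ... | yes _    | there i∈′ = allZero⁻ v is h i∈′

    allZero⁺ : ∀ {m} (v : Vector Carrier m) is → (∀ i → v i ≡ 0F) →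
               foldr (λ i b → does (v i ≟F 0F) ∧ b) true is ≡ true
    allZero⁺ v []       v≡0 = refl
    allZero⁺ v (i ∷ is) v≡0 with v i ≟F 0F
    ... | yes _    = allZero⁺ v is v≡0
    ... | no vi≢0 = ⊥-elim (vi≢0 (v≡0 i))

  infix 4 _∈ker_

  _∈ker_ : ∀ {m n} → Vector Carrier n → Matrix F m n → Set
  x ∈ker A = inKer F A x ≡ true

  module _ {m n} (A : Matrix F m n) where

    ∈ker⁻ : ∀ {x} → x ∈ker A → ∀ i → A i ⊙ x ≡ 0F
    ∈ker⁻ x∈ i = allZero⁻ _ (allFin m) x∈ (∈-allFin i)

    ∈ker⁺ : ∀ {x} → (∀ i → A i ⊙ x ≡ 0F) → x ∈ker A
    ∈ker⁺ Ax≡0 = allZero⁺ _ (allFin m) Ax≡0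

    ∈ker-resp-≗ : ∀ {x y} → x ≗ y → x ∈ker A → y ∈ker A
    ∈ker-resp-≗ x≗y x∈ = ∈ker⁺ (λ i → trans (sym (⊙-cong (A i) x≗y)) (∈ker⁻ x∈ i))

    0∈ker : (λ _ → 0F) ∈ker A
    0∈ker = ∈ker⁺ (λ i → trans (sum-cong-≗ (λ j → zeroʳ (A i j))) (sum-replicate-zero n))

    +-∈ker : ∀ {x y} → x ∈ker A → y ∈ker A → x +ᵛ y ∈ker A
    +-∈ker {x} {y} x∈ y∈ = ∈ker⁺ λ i → begin
      A i ⊙ (x +ᵛ y)          ≡⟨ ⊙-+ (A i) x y ⟩
      (A i ⊙ x) +F (A i ⊙ y) ≡⟨ cong₂ _+F_ (∈ker⁻ x∈ i) (∈ker⁻ y∈ i) ⟩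
      0F +F 0F                ≡⟨ +-identityʳ 0F ⟩
      0F                      ∎
      where open ≡-Reasoning

    ·-∈ker : ∀ c {x} → x ∈ker A → c ·ᵛ x ∈ker A
    ·-∈ker c {x} x∈ = ∈ker⁺ λ i →
      trans (⊙-· (A i) c x) (trans (cong (c *F_) (∈ker⁻ x∈ i)) (zeroʳ c))

    inKer-cong : ∀ {x y} → x ≗ y → inKer F A x ≡ inKer F A y
    inKer-cong x≗y = ⇔→≡ (mk⇔ (∈ker-resp-≗ x≗y) (∈ker-resp-≗ (sym ∘ x≗y)))

    inKer-translate : ∀ {w} → w ∈ker A → ∀ x → inKer F A (x +ᵛ w) ≡ inKer F A x
    inKer-translate {w} w∈ x = ⇔→≡ (mk⇔
      (λ x+w∈ → ∈ker-resp-≗ cancel (+-∈ker x+w∈ (·-∈ker (-F 1F) w∈)))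
      (λ x∈ → +-∈ker x∈ w∈))
      where
      open RingProperties (CommutativeRing.ring ringF) using (-1*x≈-x)
      cancel : ∀ j → (x j +F w j) +F ((-F 1F) *F w j) ≡ x j
      cancel j = trans (cong ((x j +F w j) +F_) (-1*x≈-x (w j))) (//-rightDividesʳ (w j) (x j))

    ∈kernel⁻ : ∀ {x} → x ∈ kernel F A → x ∈ker A
    ∈kernel⁻ x∈ = proj₂ (∈-filter⁻ (λ x → inKer F A x Bool.≟ true) {xs = allVecs F n} x∈)

    ∈kernel⁺ : ∀ {x} → x ∈ allVecs F n → x ∈ker A → x ∈ kernel F A
    ∈kernel⁺ = ∈-filter⁺ (λ x → inKer F A x Bool.≟ true)

  private
    to : Fin order → Carrier
    to = Inverse.to enum

    from : Carrier → Fin order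
    from = Inverse.from enum

    to-from : ∀ a → to (from a) ≡ a
    to-from a = Inverse.inverseˡ enum refl

    from-to : ∀ i → from (to i) ≡ i
    from-to i = Inverse.inverseʳ enum refl

  ∑-elems : ∀ (h : Carrier → ℕ) → ∑ (elems F) h ≡ FinSum.sum (h ∘ to)
  ∑-elems h = trans (∑-map to (allFin order) h) (∑-allFin (h ∘ to))

  ∑-elems-translate : ∀ (h : Carrier → ℕ) c → ∑ (elems F) (λ a → h (a +F c)) ≡ ∑ (elems F) h
  ∑-elems-translate h c = begin
    ∑ (elems F) (λ a → h (a +F c))    ≡⟨ ∑-elems (λ a → h (a +F c)) ⟩
    FinSum.sum (λ i → h (to i +F c)) ≡⟨ FinSum.sum-cong-≗ (λ i → cong h (sym (to-from (to i +F c)))) ⟩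
    FinSum.sum (h ∘ to ∘ shift)      ≡⟨ FinSum.sum-permute (h ∘ to) shiftPerm ⟨
    FinSum.sum (h ∘ to)              ≡⟨ ∑-elems h ⟨
    ∑ (elems F) h                    ∎
    where
    open ≡-Reasoning
    shift unshift : Fin order → Fin order
    shift i = from (to i +F c)
    unshift i = from (to i +F (-F c))
    shift-unshift : ∀ a → (a +F (-F c)) +F c ≡ a
    shift-unshift a = //-rightDividesˡ c a
    unshift-shift : ∀ a → (a +F c) +F (-F c) ≡ a
    unshift-shift a = //-rightDividesʳ c a
    shiftPerm : Permutation order order
    shiftPerm = permutation shift unshift
      (λ i → trans (cong (λ a → from (a +F c)) (to-from _)) (trans (cong from (shift-unshift (to i))) (from-to i)))
      (λ i → trans (cong (λ a → from (a +F (-F c))) (to-from _)) (trans (cong from (unshift-shift (to i))) (from-to i)))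

  Respects-≗ : ∀ {n} {B : Set} → (Vector Carrier n → B) → Set
  Respects-≗ g = ∀ {x y} → x ≗ y → g x ≡ g y

  ∑-allVecs-suc : ∀ n (g : Vector Carrier (suc n) → ℕ) →
                  ∑ (allVecs F (suc n)) g ≡ ∑ (elems F) (λ a → ∑ (allVecs F n) (λ x → g (a VF.∷ x)))
  ∑-allVecs-suc n g = trans (∑-concatMap (λ a → map (a VF.∷_) (allVecs F n)) (elems F) g)
                            (∑-cong (elems F) (λ a → ∑-map (a VF.∷_) (allVecs F n) g))

  ∑-allVecs-translate : ∀ n (g : Vector Carrier n → ℕ) → Respects-≗ g → ∀ k →
                        ∑ (allVecs F n) (λ x → g (x +ᵛ k)) ≡ ∑ (allVecs F n) g
  ∑-allVecs-translate zero    g resp k = cong (_+ 0) (resp (λ ()))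
  ∑-allVecs-translate (suc n) g resp k = begin
    ∑ (allVecs F (suc n)) (λ x → g (x +ᵛ k))
      ≡⟨ ∑-allVecs-suc n (λ x → g (x +ᵛ k)) ⟩
    ∑ (elems F) (λ a → ∑ (allVecs F n) (λ x → g ((a VF.∷ x) +ᵛ k)))
      ≡⟨ ∑-cong (elems F) (λ a → ∑-cong (allVecs F n) (λ x →
           resp (λ { Fin.zero → refl ; (Fin.suc j) → refl }))) ⟩
    ∑ (elems F) (λ a → ∑ (allVecs F n) (λ x → g ((a +F k Fin.zero) VF.∷ (x +ᵛ VF.tail k))))
      ≡⟨ ∑-cong (elems F) (λ a → ∑-allVecs-translate n (λ x → g ((a +F k Fin.zero) VF.∷ x))
                                  (λ x≗y → resp (λ { Fin.zero → refl ; (Fin.suc j) → x≗y j })) (VF.tail k)) ⟩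
    ∑ (elems F) (λ a → ∑ (allVecs F n) (λ x → g ((a +F k Fin.zero) VF.∷ x)))
      ≡⟨ ∑-elems-translate (λ a → ∑ (allVecs F n) (λ x → g (a VF.∷ x))) (k Fin.zero) ⟩
    ∑ (elems F) (λ a → ∑ (allVecs F n) (λ x → g (a VF.∷ x)))
      ≡⟨ sym (∑-allVecs-suc n g) ⟩
    ∑ (allVecs F (suc n)) g ∎
    where open ≡-Reasoning

  module _ {m n} (A : Matrix F m n) where

    ∑-kernel : ∀ (g : Vector Carrier n → ℕ) →
               ∑ (kernel F A) g ≡ ∑ (allVecs F n) (λ x → if inKer F A x then g x else 0)
    ∑-kernel g = ∑-filter (inKer F A) (allVecs F n) g

    ∑-kernel-translate : ∀ {w} → w ∈ker A → (g : Vector Carrier n → ℕ) → Respects-≗ g →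
                         ∑ (kernel F A) (λ x → g (x +ᵛ w)) ≡ ∑ (kernel F A) g
    ∑-kernel-translate {w} w∈ g resp = begin
      ∑ (kernel F A) (λ x → g (x +ᵛ w))
        ≡⟨ ∑-kernel (λ x → g (x +ᵛ w)) ⟩
      ∑ (allVecs F n) (λ x → if inKer F A x then g (x +ᵛ w) else 0)
        ≡⟨ ∑-cong (allVecs F n) (λ x →
             cong (λ b → if b then g (x +ᵛ w) else 0) (sym (inKer-translate A w∈ x))) ⟩
      ∑ (allVecs F n) (λ x → if inKer F A (x +ᵛ w) then g (x +ᵛ w) else 0)
        ≡⟨ ∑-allVecs-translate n (λ x → if inKer F A x then g x else 0)
             (λ x≗y → cong₂ (λ b c → if b then c else 0) (inKer-cong A x≗y) (resp x≗y)) w ⟩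
      ∑ (allVecs F n) (λ x → if inKer F A x then g x else 0)
        ≡⟨ sym (∑-kernel g) ⟩
      ∑ (kernel F A) g ∎
      where open ≡-Reasoning

  ∈allVecs : ∀ n (x : Vector Carrier n) → ∃ λ y → y ∈ allVecs F n × y ≗ x
  ∈allVecs zero    x = _ , here refl , λ ()
  ∈allVecs (suc n) x with ∈allVecs n (VF.tail x)
  ... | y , y∈ , y≗ = x Fin.zero VF.∷ y
                    , ∈-concatMap⁺ (λ a → map (a VF.∷_) (allVecs F n))
                                   (Any.map (λ { refl → ∈-map⁺ (x Fin.zero VF.∷_) y∈ }) x₀∈)
                    , λ { Fin.zero → refl ; (Fin.suc j) → y≗ j }
    where
    x₀∈ : x Fin.zero ∈ elems F
    x₀∈ = subst (_∈ elems F) (to-from (x Fin.zero)) (∈-map⁺ to (∈-allFin (from (x Fin.zero))))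

  kernel-nonempty : ∀ {m n} (A : Matrix F m n) → 1 ≤ length (kernel F A)
  kernel-nonempty {n = n} A with ∈allVecs n (λ _ → 0F)
  ... | y , y∈ , y≗0 = ∈-length (∈kernel⁺ A y∈ (∈ker-resp-≗ A (sym ∘ y≗0) (0∈ker A)))

  infix 5 _==_

  _==_ : Carrier → Carrier → Bool
  a == b = does (a ≟F b)

  ==⇒≡ : ∀ {a b} → a == b ≡ true → a ≡ b
  ==⇒≡ {a} {b} eq with a ≟F b
  ... | yes a≡b = a≡b

  ∑-elems-δ : ∀ c → ∑ (elems F) (λ b → indicator (c == b)) ≡ 1
  ∑-elems-δ c = begin
    ∑ (elems F) (λ b → indicator (c == b))               ≡⟨ ∑-elems (λ b → indicator (c == b)) ⟩
    FinSum.sum (λ i → indicator (c == to i))             ≡⟨ FinSum.sum-cong-≗ (cong indicator ∘ ==-to) ⟩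
    FinSum.sum (λ i → indicator (does (from c Fin.≟ i))) ≡⟨ sum-δ (from c) ⟩
    1                                                    ∎
    where
    open ≡-Reasoning
    ==-to : ∀ i → (c == to i) ≡ does (from c Fin.≟ i)
    ==-to i with c ≟F to i | from c Fin.≟ i
    ... | yes _   | yes _    = refl
    ... | no _    | no _     = refl
    ... | yes c≡ | no from≢ = ⊥-elim (from≢ (trans (cong from c≡) (from-to i)))
    ... | no c≢  | yes from≡ = ⊥-elim (c≢ (trans (sym (to-from c)) (cong to from≡)))

  ∑-split-by-value : ∀ {X : Set} (P : X → Bool) (f : X → Carrier) xs →
                     ∑ xs (indicator ∘ P) ≡ ∑ (elems F) (λ b → ∑ xs (λ x → indicator (P x ∧ (f x == b))))
  ∑-split-by-value P f xs = trans (∑-cong xs split) (∑-comm xs (elems F) _)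
    where
    split : ∀ x → indicator (P x) ≡ ∑ (elems F) (λ b → indicator (P x ∧ (f x == b)))
    split x with P x
    ... | true  = sym (∑-elems-δ (f x))
    ... | false = sym (∑-ε (elems F))

  -- Pair marginals of the uniform distribution on a kernel

  module _ {m n} (A : Matrix F m n) where

    coordCount : Fin n → Carrier → ℕ
    coordCount u a = ∑ (kernel F A) (λ x → indicator (x u == a))

    pairCount : Fin n → Fin n → Carrier → Carrier → ℕ
    pairCount u v a b = ∑ (kernel F A) (λ x → indicator ((x u == a) ∧ (x v == b)))

    Independent : Fin n → Fin n → Set
    Independent u v = ∀ a b → pairCount u v a b * length (kernel F A) ≡ coordCount u a * coordCount v b

    Frozen : Fin n → Set
    Frozen v = All (λ x → x v ≡ 0F) (kernel F A)

    frozen? : ∀ v → Dec (Frozen v)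
    frozen? v = All.all? (λ x → x v ≟F 0F) (kernel F A)

    Forces : Fin n → Fin n → Set
    Forces u v = ¬ Frozen v × All (λ x → x u ≡ 0F → x v ≡ 0F) (kernel F A)

    forces? : ∀ u v → Dec (Forces u v)
    forces? u v = ¬? (frozen? v) ×-dec All.all? (λ x → (x u ≟F 0F) →-dec (x v ≟F 0F)) (kernel F A)

    Frozen⇒Independentˡ : ∀ {u} v → Frozen u → Independent u v
    Frozen⇒Independentˡ {u} v u-frozen a b =
      ∑-indicator-∧-const (λ x → x u == a) (λ x → x v == b) (kernel F A)
        (λ x∈ → cong (_== a) (All.lookup u-frozen x∈))

    Frozen⇒Independentʳ : ∀ u {v} → Frozen v → Independent u v
    Frozen⇒Independentʳ u {v} v-frozen a b = begin
      pairCount u v a b * length (kernel F A)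
        ≡⟨ cong (_* length (kernel F A))
             (∑-cong (kernel F A) (λ x → cong indicator (∧-comm (x u == a) (x v == b)))) ⟩
      ∑ (kernel F A) (λ x → indicator ((x v == b) ∧ (x u == a))) * length (kernel F A)
        ≡⟨ ∑-indicator-∧-const (λ x → x v == b) (λ x → x u == a) (kernel F A)
             (λ x∈ → cong (_== b) (All.lookup v-frozen x∈)) ⟩
      coordCount v b * coordCount u a
        ≡⟨ ℕ.*-comm (coordCount v b) (coordCount u a) ⟩
      coordCount u a * coordCount v b ∎
      where open ≡-Reasoning

    pairCount-translate : ∀ {u v w a b} → w ∈ker A → w u ≡ a → w v ≡ b → pairCount u v a b ≡ pairCount u v 0F 0F
    pairCount-translate {u} {v} {w} {a} {b} w∈ wu≡a wv≡b = begin
      pairCount u v a b                                           ≡⟨ sym (∑-kernel-translate A w∈ g g-resp) ⟩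
      ∑ (kernel F A) (λ x → g (x +ᵛ w))                          ≡⟨ ∑-cong (kernel F A) (λ x →
                                                                        cong₂ (λ c d → indicator (c ∧ d)) (+==-cancel wu≡a) (+==-cancel wv≡b)) ⟩
      pairCount u v 0F 0F                                         ∎
      where
      open ≡-Reasoning
      g : Vector Carrier n → ℕ
      g x = indicator ((x u == a) ∧ (x v == b))
      g-resp : Respects-≗ g
      g-resp x≗y = cong₂ (λ c d → indicator ((c == a) ∧ (d == b))) (x≗y u) (x≗y v)
      +==-cancel : ∀ {c d e} → d ≡ e → ((c +F d) == e) ≡ (c == 0F)
      +==-cancel {c} {d} refl = ⇔→≡ (mk⇔
        (λ eq → dec-true (c ≟F 0F) (∙-cancelʳ d c 0F (trans (==⇒≡ eq) (sym (+-identityˡ d)))))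
        (λ eq → dec-true ((c +F d) ≟F d) (trans (cong (_+F d) (==⇒≡ eq)) (+-identityˡ d))))

    ∑-pairCount : ∀ u v a → ∑ (elems F) (pairCount u v a) ≡ coordCount u a
    ∑-pairCount u v a = sym (∑-split-by-value (λ x → x u == a) (λ x → x v) (kernel F A))

    ∑-coordCount : ∀ u → ∑ (elems F) (coordCount u) ≡ length (kernel F A)
    ∑-coordCount u = sym (trans (sym (∑-1 (kernel F A))) (∑-split-by-value (λ _ → true) (λ x → x u) (kernel F A)))

    module _ {u v y z} (y∈ : y ∈ker A) (yu≢0 : y u ≢ 0F)
             (z∈ : z ∈ker A) (zu≡0 : z u ≡ 0F) (zv≢0 : z v ≢ 0F) where

      kernel-hits : ∀ a b → ∃ λ w → w ∈ker A × w u ≡ a × w v ≡ b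
      kernel-hits a b = ŷ +ᵛ ẑ , +-∈ker A (·-∈ker A α y∈) (·-∈ker A β z∈) , wu≡a , wv≡b
        where
        open ≡-Reasoning
        scale-to : ∀ {c} (c≢0 : c ≢ 0F) d → (d *F proj₁ (inverse c c≢0)) *F c ≡ d
        scale-to {c} c≢0 d = begin
          (d *F c⁻¹) *F c ≡⟨ *-assoc d c⁻¹ c ⟩
          d *F (c⁻¹ *F c) ≡⟨ cong (d *F_) (trans (*-comm c⁻¹ c) (proj₂ (inverse c c≢0))) ⟩
          d *F 1F          ≡⟨ *-identityʳ d ⟩
          d                ∎
          where c⁻¹ = proj₁ (inverse c c≢0)
        α = a *F proj₁ (inverse (y u) yu≢0)
        ŷ = α ·ᵛ y
        β = ((-F ŷ v) +F b) *F proj₁ (inverse (z v) zv≢0)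
        ẑ = β ·ᵛ z
        wu≡a : ŷ u +F ẑ u ≡ a
        wu≡a = trans (cong₂ _+F_ (scale-to yu≢0 a) (trans (cong (β *F_) zu≡0) (zeroʳ β))) (+-identityʳ a)
        wv≡b : ŷ v +F ẑ v ≡ b
        wv≡b = trans (cong (ŷ v +F_) (scale-to zv≢0 ((-F ŷ v) +F b))) (\\-leftDividesˡ (ŷ v) b)

      Free⇒Independent : Independent u v
      Free⇒Independent a b = begin
        pairCount u v a b * length (kernel F A)     ≡⟨ cong₂ _*_ (uniform a b) length≡ ⟩
        c₀ * (q * (q * c₀))                     ≡⟨ rearrange c₀ q ⟩
        (q * c₀) * (q * c₀)                     ≡⟨ sym (cong₂ _*_ (uCount≡ a) vCount≡) ⟩
        coordCount u a * coordCount v b             ∎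
        where
        open ≡-Reasoning
        rearrange : ∀ c q → c * (q * (q * c)) ≡ (q * c) * (q * c)
        rearrange = solve-∀
        c₀ = pairCount u v 0F 0F
        q = length (elems F)
        K = kernel F A
        uniform : ∀ a b → pairCount u v a b ≡ c₀
        uniform a b with kernel-hits a b
        ... | w , w∈ , wu≡a , wv≡b = pairCount-translate w∈ wu≡a wv≡b
        sum-uniform : ∀ (h : Carrier → ℕ) {c} → (∀ a → h a ≡ c) → ∑ (elems F) h ≡ q * c
        sum-uniform h {c} h≡ = trans (∑-cong (elems F) h≡) (∑-const (elems F) c)
        uCount≡ : ∀ a → coordCount u a ≡ q * c₀
        uCount≡ a = trans (sym (∑-pairCount u v a)) (sum-uniform _ (uniform a))
        vCount≡ : coordCount v b ≡ q * c₀
        vCount≡ = trans (∑-split-by-value (λ x → x v == b) (λ x → x u) K) (sum-uniform _ λ a →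
          trans (∑-cong K (λ x → cong indicator (∧-comm (x v == b) (x u == a)))) (uniform a b))
        length≡ : length K ≡ q * (q * c₀)
        length≡ = trans (sym (∑-coordCount u)) (sum-uniform (coordCount u) uCount≡)

    ¬Forces⇒Independent : ∀ u v → ¬ Forces u v → Independent u v
    ¬Forces⇒Independent u v ¬forces with frozen? u | frozen? v
    ... | yes u-frozen | _           = Frozen⇒Independentˡ v u-frozen
    ... | no _         | yes v-frozen = Frozen⇒Independentʳ u v-frozen
    ... | no u-free    | no v-free
      with find (¬All⇒Any¬ (λ x → x u ≟F 0F) (kernel F A) u-free)
         | find (¬All⇒Any¬ (λ x → (x u ≟F 0F) →-dec (x v ≟F 0F)) (kernel F A) (¬forces ∘ (v-free ,_)))
    ... | y , y∈ , yu≢0 | z , z∈ , ¬[zu≡0⇒zv≡0] =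
      Free⇒Independent (∈kernel⁻ A y∈) yu≢0 (∈kernel⁻ A z∈) zu≡0 (¬[zu≡0⇒zv≡0] ∘ const)
      where
      zu≡0 : z u ≡ 0F
      zu≡0 with z u ≟F 0F
      ... | yes zu≡0 = zu≡0
      ... | no zu≢0  = ⊥-elim (¬[zu≡0⇒zv≡0] (⊥-elim ∘ zu≢0))

    private
      |K| k : ℕ
      |K| = length (kernel F A)
      k = ℕ.pred |K|

      |kernel|≡suc : |K| ≡ suc k
      |kernel|≡suc = sym (ℕ.suc-pred _ {{ℕ.>-nonZero (kernel-nonempty A)}})

      -- suc k′ = suc k * suc k, the denominator of a product of two marginals
      k′ : ℕ
      k′ = k + k * suc k

    dTV-pair≡ : ∀ u v → dTV-pair F A u v ≡
      ½ ℚ.* ℚΣ.∑ (elems F) (λ a → ℚΣ.∑ (elems F) (λ b →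
        ℚ.∣ pairCount u v a b /suc k ℚ.- (coordCount u a * coordCount v b) /suc k′ ∣))
    dTV-pair≡ u v = cong (½ ℚ.*_) (trans
      (ℚΣ.foldr-concatMap-map (elems F) (elems F) _)
      (ℚΣ.∑-cong (elems F) λ a → ℚΣ.∑-cong (elems F) λ b → cong₂ (λ p q → ℚ.∣ p ℚ.- q ∣)
        (μ≡ (λ x → (x u == a) ∧ (x v == b)))
        (trans (cong₂ ℚ._*_ (μ≡ (λ x → x u == a)) (μ≡ (λ x → x v == b)))
               (/suc-* (coordCount u a) k (coordCount v b) k))))
      where
      μ≡ : ∀ p → _÷ℕ_ F (count F p (kernel F A)) (length (kernel F A)) ≡ ∑ (kernel F A) (indicator ∘ p) /suc k
      μ≡ p = cong₂ (_÷ℕ_ F) (length-filter≡∑ p (kernel F A)) |kernel|≡suc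

    dTV-pair≤1 : ∀ u v → dTV-pair F A u v ℚ.≤ 1ℚ
    dTV-pair≤1 u v = ℚ.≤-trans (ℚ.≤-reflexive (dTV-pair≡ u v))
      (½∑∑∣-∣≤1 (elems F) (elems F) (λ a b → pairCount u v a b /suc k)
        (λ a b → (coordCount u a * coordCount v b) /suc k′) (λ a b → 0≤/suc (pairCount u v a b) k)
        (λ a b → 0≤/suc (coordCount u a * coordCount v b) k′) ∑pair≡1 ∑product≡1)
      where
      open ≡-Reasoning
      ∑pair≡1 : ℚΣ.∑ (elems F) (λ a → ℚΣ.∑ (elems F) (λ b → pairCount u v a b /suc k)) ≡ 1ℚ
      ∑pair≡1 = begin
        ℚΣ.∑ (elems F) (λ a → ℚΣ.∑ (elems F) (λ b → pairCount u v a b /suc k))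
          ≡⟨ ∑∑-/suc (elems F) (elems F) (pairCount u v) k ⟩
        ∑ (elems F) (λ a → ∑ (elems F) (pairCount u v a)) /suc k
          ≡⟨ cong (_/suc k) (trans (∑-cong (elems F) (∑-pairCount u v)) (trans (∑-coordCount u) |kernel|≡suc)) ⟩
        suc k /suc k
          ≡⟨ /suc-cong {suc k} {k} {1} {0} (ℕ.*-comm (suc k) 1) ⟩
        1ℚ ∎
      ∑product≡1 : ℚΣ.∑ (elems F) (λ a → ℚΣ.∑ (elems F) (λ b → (coordCount u a * coordCount v b) /suc k′))
                   ≡ 1ℚ
      ∑product≡1 = begin
        ℚΣ.∑ (elems F) (λ a → ℚΣ.∑ (elems F) (λ b → (coordCount u a * coordCount v b) /suc k′))
          ≡⟨ ∑∑-/suc (elems F) (elems F) (λ a b → coordCount u a * coordCount v b) k′ ⟩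
        ∑ (elems F) (λ a → ∑ (elems F) (λ b → coordCount u a * coordCount v b)) /suc k′
          ≡⟨ cong (_/suc k′) (∑-*-∑ (elems F) (elems F) (coordCount u) (coordCount v)) ⟩
        (∑ (elems F) (coordCount u) * ∑ (elems F) (coordCount v)) /suc k′
          ≡⟨ cong₂ (λ L L′ → (L * L′) /suc k′) (trans (∑-coordCount u) |kernel|≡suc)
                                               (trans (∑-coordCount v) |kernel|≡suc) ⟩
        (suc k * suc k) /suc k′
          ≡⟨ /suc-cong {suc k * suc k} {k′} {1} {0} (ℕ.*-comm (suc k * suc k) 1) ⟩
        1ℚ ∎

    ¬Forces⇒dTV-pair≡0 : ∀ u v → ¬ Forces u v → dTV-pair F A u v ≡ 0ℚ
    ¬Forces⇒dTV-pair≡0 u v ¬forces = begin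
      dTV-pair F A u v
        ≡⟨ dTV-pair≡ u v ⟩
      ½ ℚ.* ℚΣ.∑ (elems F) (λ a → ℚΣ.∑ (elems F) (λ b →
        ℚ.∣ pairCount u v a b /suc k ℚ.- (coordCount u a * coordCount v b) /suc k′ ∣))
        ≡⟨ cong (½ ℚ.*_) (ℚΣ.∑-cong (elems F) (λ a → ℚΣ.∑-cong (elems F) (λ b →
             cong ℚ.∣_∣ (trans (cong (ℚ._- ((coordCount u a * coordCount v b) /suc k′)) (marginals-agree a b))
                               (ℚ.+-inverseʳ ((coordCount u a * coordCount v b) /suc k′)))))) ⟩
      ½ ℚ.* ℚΣ.∑ (elems F) (λ a → ℚΣ.∑ (elems F) (λ b → 0ℚ))
        ≡⟨ cong (½ ℚ.*_) (trans (ℚΣ.∑-cong (elems F) (λ a → ℚΣ.∑-ε (elems F))) (ℚΣ.∑-ε (elems F))) ⟩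
      ½ ℚ.* 0ℚ
        ≡⟨ ℚ.*-zeroʳ ½ ⟩
      0ℚ ∎
      where
      open ≡-Reasoning
      marginals-agree : ∀ a b → pairCount u v a b /suc k ≡ (coordCount u a * coordCount v b) /suc k′
      marginals-agree a b = /suc-cong {pairCount u v a b} {k} {coordCount u a * coordCount v b} {k′} (begin
        pairCount u v a b * (suc k * suc k)  ≡⟨ sym (ℕ.*-assoc (pairCount u v a b) (suc k) (suc k)) ⟩
        pairCount u v a b * suc k * suc k    ≡⟨ cong (λ L → pairCount u v a b * L * suc k) (sym |kernel|≡suc) ⟩
        pairCount u v a b * length (kernel F A) * suc k
                                                  ≡⟨ cong (_* suc k) (¬Forces⇒Independent u v ¬forces a b) ⟩
        coordCount u a * coordCount v b * suc k ∎)

  forcedPairs : ∀ {m n} → Matrix F m n → List (Fin n) → ℕ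
  forcedPairs M vs = ∑ vs (λ u → ∑ vs (λ v → indicator (does (forces? M u v))))

  symLHS≤forcedPairs : ∀ {m n} ε (M : Matrix F m n) U → symLHS F ε M U ℚ.≤ forcedPairs M (elemsOf F U) /suc 0
  symLHS≤forcedPairs ε M U = begin
    symLHS F ε M U
      ≡⟨ ℚΣ.foldr-concatMap-map vs vs (dTV-pair F M) ⟩
    ℚΣ.∑ vs (λ u → ℚΣ.∑ vs (dTV-pair F M u))
      ≤⟨ ℚ∑-mono-≤ vs (λ u → ℚ∑-mono-≤ vs (λ v →
           ≤-indicator (forces? M u v) (¬Forces⇒dTV-pair≡0 M u v) (dTV-pair≤1 M u v))) ⟩
    ℚΣ.∑ vs (λ u → ℚΣ.∑ vs (λ v → indicator (does (forces? M u v)) /suc 0))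
      ≡⟨ ∑∑-/suc vs vs (λ u v → indicator (does (forces? M u v))) 0 ⟩
    forcedPairs M vs /suc 0 ∎
    where
    open ℚ.≤-Reasoning
    vs = elemsOf F U

  asymmetric⇒forcedPairs : ∀ {m n} p dm (M : Matrix F m n) U → symmetric? F (p /suc dm) M U ≡ false →
    p * (length (elemsOf F U) * length (elemsOf F U)) ≤ forcedPairs M (elemsOf F U) * suc dm
  asymmetric⇒forcedPairs p dm M U asym =
    subst₂ _≤_ (ℕ.*-identityʳ _) (cong (λ d → forcedPairs M vs * suc d) (ℕ.*-identityʳ dm))
    (/suc-cancel-≤ {p * (s * s)} {dm * 1} {forcedPairs M vs} {0} (begin
      (p * (s * s)) /suc (dm * 1)  ≡⟨ trans (cong (p /suc dm ℚ.*_) (/suc-* s 0 s 0)) (/suc-* p dm (s * s) 0) ⟨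
      symRHS F (p /suc dm) M U     ≤⟨ ℚ.≮⇒≥ (λ lhs<rhs → true≢false (trans (sym (dec-true (_ ℚ.<? _) lhs<rhs)) asym)) ⟩
      symLHS F (p /suc dm) M U     ≤⟨ symLHS≤forcedPairs (p /suc dm) M U ⟩
      forcedPairs M vs /suc 0      ∎))
    where
    open ℚ.≤-Reasoning
    vs = elemsOf F U
    s = length vs
    true≢false : true ≢ false
    true≢false ()

  -- Pinning coordinates

  module _ {m n} (A : Matrix F m n) where

    private
      pin-row-A : ∀ is r a → Fin.splitAt m r ≡ inj₁ a → ∀ j → pin F A is r j ≡ A a j
      pin-row-A is r a split≡ j with Fin.splitAt m r
      pin-row-A is r a refl   j | inj₁ .a = refl

      pin-row-unit : ∀ is r k → Fin.splitAt m r ≡ inj₂ k → ∀ j → pin F A is r j ≡ unit (List.lookup is k) j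
      pin-row-unit is r k split≡ j with Fin.splitAt m r
      pin-row-unit is r k refl   j | inj₂ .k = refl

    ∈ker-pin-∷ : ∀ i is {x} → x ∈ker pin F A (i ∷ is) → x ∈ker pin F A is × x i ≡ 0F
    ∈ker-pin-∷ i is {x} x∈ = ∈ker⁺ (pin F A is) rows , xi≡0
      where
      l = length is
      row≡ : ∀ {r s : Vector Carrier n} → r ≗ s → r ⊙ x ≡ s ⊙ x
      row≡ r≗s = sum-cong-≗ (λ j → cong (_*F x j) (r≗s j))
      rows : ∀ r → pin F A is r ⊙ x ≡ 0F
      rows r with Fin.splitAt m r
      ... | inj₁ a = trans (row≡ (λ j → sym (pin-row-A (i ∷ is) _ a (Fin.splitAt-↑ˡ m a (suc l)) j)))
                           (∈ker⁻ (pin F A (i ∷ is)) x∈ (a ↑ˡ suc l))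
      ... | inj₂ k = trans (row≡ (λ j → sym (pin-row-unit (i ∷ is) _ (Fin.suc k)
                                                         (Fin.splitAt-↑ʳ m (suc l) (Fin.suc k)) j)))
                           (∈ker⁻ (pin F A (i ∷ is)) x∈ (m ↑ʳ Fin.suc k))
      xi≡0 : x i ≡ 0F
      xi≡0 = trans (sym (unit-⊙ i x))
        (trans (row≡ (λ j → sym (pin-row-unit (i ∷ is) _ Fin.zero (Fin.splitAt-↑ʳ m (suc l) Fin.zero) j)))
               (∈ker⁻ (pin F A (i ∷ is)) x∈ (m ↑ʳ Fin.zero)))

    ∈kernel-pin-∷ : ∀ i is {x} → x ∈ kernel F (pin F A (i ∷ is)) → x ∈ kernel F (pin F A is) × x i ≡ 0F
    ∈kernel-pin-∷ i is {x} x∈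
      with ∈-filter⁻ (λ x → inKer F (pin F A (i ∷ is)) x Bool.≟ true) {xs = allVecs F n} x∈
    ... | x∈allVecs , x∈ker with ∈ker-pin-∷ i is x∈ker
    ...   | x∈ker′ , xi≡0 = ∈kernel⁺ (pin F A is) x∈allVecs x∈ker′ , xi≡0

    Frozen-pin-∷ : ∀ i is {v} → Frozen (pin F A is) v → Frozen (pin F A (i ∷ is)) v
    Frozen-pin-∷ i is frozen = All.tabulate (All.lookup frozen ∘ proj₁ ∘ ∈kernel-pin-∷ i is)

    Forces⇒Frozen-pin-∷ : ∀ i is {v} → Forces (pin F A is) i v → Frozen (pin F A (i ∷ is)) v
    Forces⇒Frozen-pin-∷ i is (_ , vanishes) = All.tabulate λ x∈ →
      All.lookup vanishes (proj₁ (∈kernel-pin-∷ i is x∈)) (proj₂ (∈kernel-pin-∷ i is x∈))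

    unfrozenCount : List (Fin n) → List (Fin n) → ℕ
    unfrozenCount vs is = ∑ vs (λ v → indicator (not (does (frozen? (pin F A is) v))))

  unfrozenCount-pin : ∀ {m n} (A : Matrix F m n) vs is →
    ∑ vs (λ i → unfrozenCount A vs (i ∷ is)) + forcedPairs (pin F A is) vs ≤ length vs * unfrozenCount A vs is
  unfrozenCount-pin A vs is = begin
    ∑ vs (λ i → unfrozenCount A vs (i ∷ is)) + forcedPairs (pin F A is) vs
      ≡⟨ sym (∑-∙ vs _ _) ⟩
    ∑ vs (λ i → unfrozenCount A vs (i ∷ is) + ∑ vs (λ v → indicator (does (forces? (pin F A is) i v))))
      ≤⟨ ∑-mono-≤ vs (λ i → ℕ.≤-trans (ℕ.≤-reflexive (sym (∑-∙ vs _ _))) (∑-mono-≤ vs (λ v →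
           not-indicator-+-≤ (frozen? (pin F A (i ∷ is)) v) (forces? (pin F A is) i v) (frozen? (pin F A is) v)
             (Frozen-pin-∷ A i is) (Forces⇒Frozen-pin-∷ A i is) proj₁))) ⟩
    ∑ vs (λ _ → unfrozenCount A vs is)
      ≡⟨ ∑-const vs _ ⟩
    length vs * unfrozenCount A vs is ∎
    where open ℕ.≤-Reasoning

  -- Averaging over random pinnings

  Nonempty⇒1≤|elemsOf| : ∀ {n} {U : Subset n} → Nonempty U → 1 ≤ length (elemsOf F U)
  Nonempty⇒1≤|elemsOf| (i , i∈U) = ∈-length (∈-filter⁺ (_∈? _) (∈-allFin i) i∈U)

  module _ {m n} (A : Matrix F m n) (U : Subset n) (p dm : ℕ) where

    private
      vs = elemsOf F U
      s = length vs
      d = suc dm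
      ε = p /suc dm
      symmetricAfter : List (Fin n) → Bool
      symmetricAfter is = symmetric? F ε (pin F A is) U

    symmetricCount asymmetricCount potential : ℕ → ℕ
    symmetricCount θ  = count F symmetricAfter (tuples F U θ)
    asymmetricCount θ = ∑ (tuples F U θ) (λ is → indicator (not (symmetricAfter is)))
    potential θ       = ∑ (tuples F U θ) (unfrozenCount A vs)

    length-tuples : ∀ θ → length (tuples F U θ) ≡ s ^ θ
    length-tuples zero    = refl
    length-tuples (suc θ) = begin
      length (tuples F U (suc θ))                          ≡⟨ sym (∑-1 (tuples F U (suc θ))) ⟩
      ∑ (tuples F U (suc θ)) (λ _ → 1)                     ≡⟨ ∑-concatMap (λ i → map (i ∷_) (tuples F U θ)) vs _ ⟩
      ∑ vs (λ i → ∑ (map (i ∷_) (tuples F U θ)) (λ _ → 1)) ≡⟨ ∑-cong vs (λ i → trans (∑-1 (map (i ∷_) (tuples F U θ)))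
                                                                  (trans (List.length-map (i ∷_) (tuples F U θ)) (length-tuples θ))) ⟩
      ∑ vs (λ _ → s ^ θ)                                   ≡⟨ ∑-const vs (s ^ θ) ⟩
      s ^ suc θ                                            ∎
      where open ≡-Reasoning

    symmetric+asymmetric : ∀ θ → symmetricCount θ + asymmetricCount θ ≡ s ^ θ
    symmetric+asymmetric θ = begin
      symmetricCount θ + asymmetricCount θ ≡⟨ cong (_+ asymmetricCount θ) (length-filter≡∑ _ (tuples F U θ)) ⟩
      ∑ (tuples F U θ) (indicator ∘ symmetricAfter) + asymmetricCount θ
                                           ≡⟨ sym (∑-∙ (tuples F U θ) _ _) ⟩
      ∑ (tuples F U θ) (λ is → indicator (symmetricAfter is) + indicator (not (symmetricAfter is)))
                                           ≡⟨ ∑-cong (tuples F U θ) (λ is → indicator-+-not (symmetricAfter is)) ⟩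
      ∑ (tuples F U θ) (λ _ → 1)           ≡⟨ trans (∑-1 (tuples F U θ)) (length-tuples θ) ⟩
      s ^ θ                                ∎
      where
      open ≡-Reasoning
      indicator-+-not : ∀ b → indicator b + indicator (not b) ≡ 1
      indicator-+-not true  = refl
      indicator-+-not false = refl

    potential-suc : ∀ θ → potential (suc θ) ≡ ∑ (tuples F U θ) (λ is → ∑ vs (λ i → unfrozenCount A vs (i ∷ is)))
    potential-suc θ = trans (∑-concatMap (λ i → map (i ∷_) (tuples F U θ)) vs _)
      (trans (∑-cong vs (λ i → ∑-map (i ∷_) (tuples F U θ) _)) (∑-comm vs (tuples F U θ) _))

    pin-step : ∀ is → d * ∑ vs (λ i → unfrozenCount A vs (i ∷ is)) + p * (s * s) * indicator (not (symmetricAfter is))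
                      ≤ d * s * unfrozenCount A vs is
    pin-step is = by-symmetry (symmetricAfter is) refl
      where
      open ℕ.≤-Reasoning
      next = ∑ vs (λ i → unfrozenCount A vs (i ∷ is))
      forced = forcedPairs (pin F A is) vs
      pinning-bound : d * (next + forced) ≤ d * s * unfrozenCount A vs is
      pinning-bound = ℕ.≤-trans (ℕ.*-monoʳ-≤ d (unfrozenCount-pin A vs is)) (ℕ.≤-reflexive (sym (ℕ.*-assoc d s _)))
      by-symmetry : ∀ b → symmetricAfter is ≡ b →
                    d * next + p * (s * s) * indicator (not b) ≤ d * s * unfrozenCount A vs is
      by-symmetry true _ = begin
        d * next + p * (s * s) * 0     ≡⟨ trans (cong (d * next +_) (ℕ.*-zeroʳ (p * (s * s)))) (ℕ.+-identityʳ _) ⟩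
        d * next                       ≤⟨ ℕ.*-monoʳ-≤ d (ℕ.m≤m+n next forced) ⟩
        d * (next + forced)            ≤⟨ pinning-bound ⟩
        d * s * unfrozenCount A vs is  ∎
      by-symmetry false asymmetric = begin
        d * next + p * (s * s) * 1     ≡⟨ cong (d * next +_) (ℕ.*-identityʳ (p * (s * s))) ⟩
        d * next + p * (s * s)         ≤⟨ ℕ.+-monoʳ-≤ (d * next) (asymmetric⇒forcedPairs p dm (pin F A is) U asymmetric) ⟩
        d * next + forced * d          ≡⟨ cong (d * next +_) (ℕ.*-comm forced d) ⟩
        d * next + d * forced          ≡⟨ ℕ.*-distribˡ-+ d next forced ⟨
        d * (next + forced)            ≤⟨ pinning-bound ⟩
        d * s * unfrozenCount A vs is  ∎

    potential-step : ∀ θ → d * potential (suc θ) + p * (s * s) * asymmetricCount θ ≤ d * s * potential θ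
    potential-step θ = begin
      d * potential (suc θ) + p * (s * s) * asymmetricCount θ
        ≡⟨ cong₂ _+_ (trans (cong (d *_) (potential-suc θ)) (sym (∑-*ˡ d (tuples F U θ) _)))
                     (sym (∑-*ˡ (p * (s * s)) (tuples F U θ) _)) ⟩
      ∑ (tuples F U θ) (λ is → d * ∑ vs (λ i → unfrozenCount A vs (i ∷ is)))
        + ∑ (tuples F U θ) (λ is → p * (s * s) * indicator (not (symmetricAfter is)))
        ≡⟨ sym (∑-∙ (tuples F U θ) _ _) ⟩
      ∑ (tuples F U θ) (λ is → d * ∑ vs (λ i → unfrozenCount A vs (i ∷ is))
                                 + p * (s * s) * indicator (not (symmetricAfter is)))
        ≤⟨ ∑-mono-≤ (tuples F U θ) pin-step ⟩
      ∑ (tuples F U θ) (λ is → d * s * unfrozenCount A vs is)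
        ≡⟨ ∑-*ˡ (d * s) (tuples F U θ) _ ⟩
      d * s * potential θ ∎
      where open ℕ.≤-Reasoning

    potential-1 : potential 1 ≤ s * s
    potential-1 = begin
      potential 1                               ≡⟨ trans (potential-suc 0) (ℕ.+-identityʳ _) ⟩
      ∑ vs (λ i → unfrozenCount A vs (i ∷ [])) ≤⟨ ∑-mono-≤ vs (λ i →
                                                    ℕ.≤-trans (∑-mono-≤ vs (λ v → indicator≤1 _)) (ℕ.≤-reflexive (∑-1 vs))) ⟩
      ∑ vs (λ _ → s)                            ≡⟨ ∑-const vs s ⟩
      s * s                                     ∎
      where open ℕ.≤-Reasoning

    asymmetric-horner : 1 ≤ s → ∀ t → p * horner s asymmetricCount t ≤ d * s ^ t
    asymmetric-horner 1≤s t =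
      ℕ.*-cancelʳ-≤ _ _ (s * s) {{ℕ.m*n≢0 s s {{ℕ.>-nonZero 1≤s}} {{ℕ.>-nonZero 1≤s}}}} (begin
      p * horner s asymmetricCount t * (s * s) ≡⟨ swap p (horner s asymmetricCount t) (s * s) ⟩
      p * (s * s) * horner s asymmetricCount t ≤⟨ horner-telescope s d (p * (s * s)) potential asymmetricCount
                                                                    (potential-step ∘ suc) t ⟩
      d * potential 1 * s ^ t                  ≤⟨ ℕ.*-monoˡ-≤ (s ^ t) (ℕ.*-monoʳ-≤ d potential-1) ⟩
      d * (s * s) * s ^ t                      ≡⟨ swap d (s * s) (s ^ t) ⟩
      d * s ^ t * (s * s)                      ∎)
      where
      open ℕ.≤-Reasoning
      swap : ∀ x y z → x * y * z ≡ x * z * y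
      swap = solve-∀

    module _ (1≤s : 1 ≤ s) where

      private
        suc-pred-^ : ∀ t → suc (ℕ.pred (s ^ t)) ≡ s ^ t
        suc-pred-^ t = ℕ.suc-pred (s ^ t) {{ℕ.m^n≢0 s t {{ℕ.>-nonZero 1≤s}}}}

        ÷ℕ-^ : ∀ a t → _÷ℕ_ F a (s ^ t) ≡ a /suc ℕ.pred (s ^ t)
        ÷ℕ-^ a t = cong (_÷ℕ_ F a) (sym (suc-pred-^ t))

      sumℚ-horner : ∀ (f : ℕ → ℕ) t →
                    sumℚ F (map (λ θ → _÷ℕ_ F (f θ) (s ^ θ)) (map suc (upTo t))) ≡ horner s f t /suc ℕ.pred (s ^ t)
      sumℚ-horner f zero    = sym (0/suc 0)
      sumℚ-horner f (suc t) = begin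
        ℚΣ.∑ (map suc (upTo (suc t))) g
          ≡⟨ cong (λ L → ℚΣ.∑ L g)
               (trans (cong (map suc) (sym (List.upTo-∷ʳ t))) (List.map-++ suc (upTo t) (t ∷ []))) ⟩
        ℚΣ.∑ (map suc (upTo t) List.++ (suc t ∷ [])) g
          ≡⟨ ℚΣ.∑-++ (map suc (upTo t)) (suc t ∷ []) g ⟩
        ℚΣ.∑ (map suc (upTo t)) g ℚ.+ (g (suc t) ℚ.+ 0ℚ)
          ≡⟨ cong₂ ℚ._+_ (sumℚ-horner f t) (trans (ℚ.+-identityʳ _) (÷ℕ-^ (f (suc t)) (suc t))) ⟩
        horner s f t /suc ℕ.pred (s ^ t) ℚ.+ f (suc t) /suc ℕ.pred (s ^ suc t)
          ≡⟨ cong (ℚ._+ f (suc t) /suc ℕ.pred (s ^ suc t))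
               (/suc-cong {horner s f t} {ℕ.pred (s ^ t)} {s * horner s f t} {ℕ.pred (s ^ suc t)} scale) ⟩
        (s * horner s f t) /suc ℕ.pred (s ^ suc t) ℚ.+ f (suc t) /suc ℕ.pred (s ^ suc t)
          ≡⟨ /suc-+ (s * horner s f t) (f (suc t)) (ℕ.pred (s ^ suc t)) ⟩
        horner s f (suc t) /suc ℕ.pred (s ^ suc t) ∎
        where
        open ≡-Reasoning
        g : ℕ → ℚ
        g θ = _÷ℕ_ F (f θ) (s ^ θ)
        scale : horner s f t * suc (ℕ.pred (s ^ suc t)) ≡ s * horner s f t * suc (ℕ.pred (s ^ t))
        scale = begin
          horner s f t * suc (ℕ.pred (s * s ^ t)) ≡⟨ cong (horner s f t *_) (suc-pred-^ (suc t)) ⟩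
          horner s f t * (s * s ^ t)              ≡⟨ rearrange (horner s f t) s (s ^ t) ⟩
          s * horner s f t * s ^ t                ≡⟨ cong (s * horner s f t *_) (sym (suc-pred-^ t)) ⟩
          s * horner s f t * suc (ℕ.pred (s ^ t)) ∎
          where
          rearrange : ∀ h s P → h * (s * P) ≡ s * h * P
          rearrange = solve-∀

      probSym-bound : 1 ≤ p → p ≤ d → (1ℚ ℚ.- ε) ℚ.< probSym F (suc (d * d)) ε A U
      probSym-bound 1≤p p≤d = subst₂ ℚ._<_ (sym (1-/suc p≤d)) (sym probSym≡)
        (/suc-mono-< {d ∸ p} {dm} {X * 1} {d * d + ℕ.pred S * Θ} cross-multiplied)
        where
        Θ = suc (d * d)
        S = s ^ Θ
        X = horner s symmetricCount Θ
        Q = horner s asymmetricCount Θ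
        probSym≡ : probSym F Θ ε A U ≡ (X * 1) /suc (d * d + ℕ.pred S * Θ)
        probSym≡ = trans (cong (ℚ._* 1 /suc (d * d)) (sumℚ-horner symmetricCount Θ)) (/suc-* X (ℕ.pred S) 1 (d * d))
        X+Q≡ : X + Q ≡ Θ * S
        X+Q≡ = horner-complement s symmetricCount asymmetricCount (symmetric+asymmetric ∘ suc) Θ
        cross-multiplied : (d ∸ p) * suc (d * d + ℕ.pred S * Θ) ℕ.< X * 1 * d
        cross-multiplied = subst₂ ℕ._<_ (cong (λ S′ → (d ∸ p) * (S′ * Θ)) (sym (suc-pred-^ Θ)))
                                         (cong (_* d) (sym (ℕ.*-identityʳ X)))
          (complement-ratio-< p d X Q S 1≤p p≤d (ℕ.m^n>0 s {{ℕ.>-nonZero 1≤s}} Θ) X+Q≡ (asymmetric-horner 1≤s Θ))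

positive-as-fraction : ∀ ε → 0ℚ < ε → ε ℚ.≤ 1ℚ → ∃ λ p → ∃ λ dm → ε ≡ p /suc dm × 1 ≤ p × p ≤ suc dm
positive-as-fraction (ℚ.mkℚ (ℤ.+ zero) dm _) 0<ε _ with ℚ.positive 0<ε
... | ()
positive-as-fraction (ℚ.mkℚ ℤ.-[1+ k ] dm _) 0<ε _ with ℚ.positive 0<ε
... | ()
positive-as-fraction ε@(ℚ.mkℚ (ℤ.+ suc p) dm _) _ ε≤1 = suc p , dm , ε≡ , ℕ.s≤s ℕ.z≤n ,
  subst₂ _≤_ (ℕ.*-identityʳ (suc p)) (ℕ.*-identityˡ (suc dm))
    (/suc-cancel-≤ {suc p} {dm} {1} {0} (subst (ℚ._≤ 1ℚ) ε≡ ε≤1))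
  where
  ε≡ : ε ≡ suc p /suc dm
  ε≡ = sym (ℚ.fromℚᵘ-toℚᵘ ε)

lemma2p3 : (ε : ℚ) → 0ℚ < ε → ε < 1ℚ →
    Σ ℕ λ Θ → (Θ ≥ 1) ×
      ((F : FiniteField) → (m n : ℕ) → (A : Matrix F m n) → (U : Subset n) →
        Nonempty U → (1ℚ - ε) < probSym F Θ ε A U)
lemma2p3 ε 0<ε ε<1 with positive-as-fraction ε 0<ε (ℚ.<⇒≤ ε<1)
... | p , dm , refl , 1≤p , p≤d = suc (suc dm * suc dm) , ℕ.s≤s ℕ.z≤n ,
  λ F m n A U U≢∅ → probSym-bound F A U p dm (Nonempty⇒1≤|elemsOf| F U≢∅) 1≤p p≤d
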